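{- If $\Gamma\vdash r:A$ and $r\to r'$ then $\Gamma\vdash r':A$.
   Context: Modal type system. Disjoint countably infinite sets $\mathbb A$ (atoms) and $\mathbb X$ (unknowns). Types: $A::=o\mid \mathbb N\mid A\to A\mid \Box A$. Constants $C$ with types, including $\top:o$, $\bot:o$, $\mathrm{isapp}_A:\Box A\to o$. Terms: $r::=C\mid a\mid X_@\mid \lambda a{:}A.r\mid rr\mid \Box r\mid \mathrm{letbox}\ X=s\ \mathrm{in}\ r$ (up to $\alpha$-equivalence; $\lambda$ binds $a$, letbox binds $X$ in $r$). $\mathrm{fa}$ (free atoms): $\mathrm{fa}(C)=\mathrm{fa}(X_@)=\emptyset$, $\mathrm{fa}(a)=\{a\}$, $\mathrm{fa}(\lambda a{:}A.r)=\mathrm{fa}(r)\setminus\{a\}$, $\mathrm{fa}(rs)=\mathrm{fa}(r)\cup\mathrm{fa}(s)$, $\mathrm{fa}(\Box r)=\mathrm{fa}(r)$, $\mathrm{fa}(\mathrm{letbox}\ X=s\ \mathrm{in}\ r)=\mathrm{fa}(r)\cup\mathrm{fa}(s)$; $\mathrm{fv}$ (free unknowns) analogously with $\mathrm{fv}(X_@)=\{X\}$ and letbox binding $X$. Typing contexts: finite partial functions from $\mathbb A\cup\mathbb X$ to types. Rules: (Hyp) $\Gamma,a{:}A\vdash a:A$; (Const) $\Gamma\vdash C:\mathrm{type}(C)$; (${\to}$I) from $\Gamma,a{:}A\vdash r:B$ infer $\Gamma\vdash\lambda a{:}A.r:A\to B$; (${\to}$E) from $\Gamma\vdash r':A\to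 B$, $\Gamma\vdash r:A$ infer $\Gamma\vdash r'r:B$; ($\Box$I) from $\Gamma\vdash r:A$, $\mathrm{fa}(r)=\emptyset$ infer $\Gamma\vdash\Box r:\Box A$; ($\Box$E) from $\Gamma\vdash s:\Box A$, $\Gamma,X{:}\Box A\vdash r:B$ infer $\Gamma\vdash\mathrm{letbox}\ X=s\ \mathrm{in}\ r:B$; (Ext) $\Gamma,X{:}\Box A\vdash X_@:A$. Substitution: $r[a{:=}t]$ is capture-avoiding substitution of $t$ for the atom $a$, acting structurally with $(\Box r)[a{:=}t]=\Box(r[a{:=}t])$ and $X_@[a{:=}t]=X_@$. $r[X{:=}\Box s]$ (for $\mathrm{fa}(s)=\emptyset$) acts structurally (capture-avoiding) with $X_@[X{:=}\Box s]=s$ and $Y_@[X{:=}\Box s]=Y_@$ for $Y\neq X$. Reduction $\to$: ($\beta$) $(\lambda a{:}A.r)r'\to r[a{:=}r']$; ($\beta_\Box$) $\mathrm{letbox}\ X=\Box s\ \mathrm{in}\ r\to r[X{:=}\Box s]$; (cnga) if $r\to r'$ and $s\to s'$ then $rs\to r's'$; (cngl) if $r\to r'$ then $\lambda a{:}A.r\to\lambda a{:}A.r'$; (cnge) if $r\to r'$ and $s\to s'$ then $\mathrm{letbox}\ X=s\ \mathrm{in}\ r\to\mathrm{letbox}\ X=s'\ \mathrm{in}\ r'$; $\mathrm{isapp}\,\Box(r'r)\to\top$; $\mathrm{isapp}\,\Box(r)\to\bot$ when $r$ is not an application. -}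

module Defs where

open import Data.Nat using (ℕ; zero; suc)
open import Data.Fin using (Fin; zero; suc)
open import Data.List using (List; []; _∷_; _++_)
open import Data.Vec using (Vec; lookup) renaming (_∷_ to _▸_)
open import Relation.Binary.PropositionalEquality using (_≡_)
open import Relation.Nullary using (¬_)

infixr 7 _⇒_
data Ty : Set where
  o   : Ty
  nat : Ty
  _⇒_ : Ty → Ty → Ty
  □_  : Ty → Ty

data Const (K : Set) : Set where
  top   : Const K
  bot   : Const K
  isapp : Ty → Const K
  other : K → Const K

typeOf : {K : Set} → (K → Ty) → Const K → Ty
typeOf ty top       = o
typeOf ty bot       = o
typeOf ty (isapp A) = (□ A) ⇒ o
typeOf ty (other k) = ty k

-- Terms, well-scoped de Bruijn: n atoms in scope, m unknowns in scope.
data Tm (K : Set) (n m : ℕ) : Set where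
  con    : Const K → Tm K n m
  atom   : Fin n → Tm K n m
  unk    : Fin m → Tm K n m
  lam    : Ty → Tm K (suc n) m → Tm K n m
  app    : Tm K n m → Tm K n m → Tm K n m
  box    : Tm K n m → Tm K n m
  letbox : Tm K n m → Tm K n (suc m) → Tm K n m

dropZero : {n : ℕ} → List (Fin (suc n)) → List (Fin n)
dropZero []            = []
dropZero (zero  ∷ xs)  = dropZero xs
dropZero (suc i ∷ xs)  = i ∷ dropZero xs

fa : {K : Set} {n m : ℕ} → Tm K n m → List (Fin n)
fa (con c)      = []
fa (atom a)     = a ∷ []
fa (unk X)      = []
fa (lam A r)    = dropZero (fa r)
fa (app r s)    = fa r ++ fa s
fa (box r)      = fa r
fa (letbox s r) = fa r ++ fa s

extR : {n n' : ℕ} → (Fin n → Fin n') → Fin (suc n) → Fin (suc n')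
extR ρ zero    = zero
extR ρ (suc i) = suc (ρ i)

renA : {K : Set} {n n' m : ℕ} → (Fin n → Fin n') → Tm K n m → Tm K n' m
renA ρ (con c)      = con c
renA ρ (atom a)     = atom (ρ a)
renA ρ (unk X)      = unk X
renA ρ (lam A r)    = lam A (renA (extR ρ) r)
renA ρ (app r s)    = app (renA ρ r) (renA ρ s)
renA ρ (box r)      = box (renA ρ r)
renA ρ (letbox s r) = letbox (renA ρ s) (renA ρ r)

renU : {K : Set} {n m m' : ℕ} → (Fin m → Fin m') → Tm K n m → Tm K n m'
renU ρ (con c)      = con c
renU ρ (atom a)     = atom a
renU ρ (unk X)      = unk (ρ X)
renU ρ (lam A r)    = lam A (renU ρ r)
renU ρ (app r s)    = app (renU ρ r) (renU ρ s)
renU ρ (box r)      = box (renU ρ r)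
renU ρ (letbox s r) = letbox (renU ρ s) (renU (extR ρ) r)

extSA : {K : Set} {n n' m : ℕ} → (Fin n → Tm K n' m) → Fin (suc n) → Tm K (suc n') m
extSA σ zero    = atom zero
extSA σ (suc i) = renA suc (σ i)

substA : {K : Set} {n n' m : ℕ} → (Fin n → Tm K n' m) → Tm K n m → Tm K n' m
substA σ (con c)      = con c
substA σ (atom a)     = σ a
substA σ (unk X)      = unk X
substA σ (lam A r)    = lam A (substA (extSA σ) r)
substA σ (app r s)    = app (substA σ r) (substA σ s)
substA σ (box r)      = box (substA σ r)
substA σ (letbox s r) = letbox (substA σ s) (substA (λ i → renU suc (σ i)) r)

-- r[a:=t] for the outermost bound atom a (index 0)
single : {A : Set} {n : ℕ} → A → (Fin n → A) → Fin (suc n) → A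
single t f zero    = t
single t f (suc i) = f i

_[a≔_] : {K : Set} {n m : ℕ} → Tm K (suc n) m → Tm K n m → Tm K n m
r [a≔ t ] = substA (single t atom) r

extSU : {K : Set} {n m m' : ℕ} → (Fin m → Tm K n m') → Fin (suc m) → Tm K n (suc m')
extSU σ zero    = unk zero
extSU σ (suc i) = renU suc (σ i)

substU : {K : Set} {n m m' : ℕ} → (Fin m → Tm K n m') → Tm K n m → Tm K n m'
substU σ (con c)      = con c
substU σ (atom a)     = atom a
substU σ (unk X)      = σ X
substU σ (lam A r)    = lam A (substU (λ i → renA suc (σ i)) r)
substU σ (app r s)    = app (substU σ r) (substU σ s)
substU σ (box r)      = box (substU σ r)
substU σ (letbox s r) = letbox (substU σ s) (substU (extSU σ) r)

-- r[X:=□s] for the outermost bound unknown X (index 0): X_@ ↦ s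
_[X≔□_] : {K : Set} {n m : ℕ} → Tm K n (suc m) → Tm K n m → Tm K n m
r [X≔□ s ] = substU (single s unk) r

data _⊢_∣_⊢_∶_ {K : Set} (ty : K → Ty) {n m : ℕ} (Γ : Vec Ty n) (Δ : Vec Ty m)
     : Tm K n m → Ty → Set where
  hyp   : (a : Fin n) → ty ⊢ Γ ∣ Δ ⊢ atom a ∶ lookup Γ a
  const : (c : Const K) → ty ⊢ Γ ∣ Δ ⊢ con c ∶ typeOf ty c
  →I    : {A B : Ty} {r : Tm K (suc n) m} →
          ty ⊢ (A ▸ Γ) ∣ Δ ⊢ r ∶ B → ty ⊢ Γ ∣ Δ ⊢ lam A r ∶ (A ⇒ B)
  →E    : {A B : Ty} {r' r : Tm K n m} →
          ty ⊢ Γ ∣ Δ ⊢ r' ∶ (A ⇒ B) → ty ⊢ Γ ∣ Δ ⊢ r ∶ A → ty ⊢ Γ ∣ Δ ⊢ app r' r ∶ B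
  □I    : {A : Ty} {r : Tm K n m} →
          ty ⊢ Γ ∣ Δ ⊢ r ∶ A → fa r ≡ [] → ty ⊢ Γ ∣ Δ ⊢ box r ∶ (□ A)
  □E    : {A B : Ty} {s : Tm K n m} {r : Tm K n (suc m)} →
          ty ⊢ Γ ∣ Δ ⊢ s ∶ (□ A) → ty ⊢ Γ ∣ ((□ A) ▸ Δ) ⊢ r ∶ B →
          ty ⊢ Γ ∣ Δ ⊢ letbox s r ∶ B
  ext   : {A : Ty} (X : Fin m) → lookup Δ X ≡ (□ A) → ty ⊢ Γ ∣ Δ ⊢ unk X ∶ A

data IsApp {K : Set} {n m : ℕ} : Tm K n m → Set where
  isApp : (r' r : Tm K n m) → IsApp (app r' r)

infix 4 _⟶_
data _⟶_ {K : Set} {n m : ℕ} : Tm K n m → Tm K n m → Set where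
  β     : (A : Ty) (r : Tm K (suc n) m) (r' : Tm K n m) →
          app (lam A r) r' ⟶ r [a≔ r' ]
  β□    : (s : Tm K n m) (r : Tm K n (suc m)) →
          letbox (box s) r ⟶ r [X≔□ s ]
  cnga  : {r r' s s' : Tm K n m} → r ⟶ r' → s ⟶ s' → app r s ⟶ app r' s'
  cngl  : {A : Ty} {r r' : Tm K (suc n) m} → r ⟶ r' → lam A r ⟶ lam A r'
  cnge  : {s s' : Tm K n m} {r r' : Tm K n (suc m)} →
          r ⟶ r' → s ⟶ s' → letbox s r ⟶ letbox s' r'
  isappT : (A : Ty) (r' r : Tm K n m) →
           app (con (isapp A)) (box (app r' r)) ⟶ con top
  isappF : (A : Ty) (r : Tm K n m) → ¬ IsApp r →
           app (con (isapp A)) (box r) ⟶ con bot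

module Submission where

-- Congruence steps follow
-- directly from the induction hypotheses, and the two isapp steps produce
-- constants of type o, which is the type of isapp _ applied to a boxed term.
-- The real content lies in the two redex steps, which need a substitution
-- lemma for each kind of variable:
--   β  : Γ, a:A ⊢ r : B  and  Γ ⊢ t : A  give  Γ ⊢ r[a:=t] : B;
--   β□ : Δ, X:□A ⊢ r : B, Δ ⊢ s : A and fa s = ∅  give  Δ ⊢ r[X:=□s] : B.
-- Both are instances of general statements about simultaneous substitutions.
-- The only subtle point is the side condition fa r = ∅ of rule □I: it must
-- survive renaming and substitution.

open import Defs
open import Data.Nat using (ℕ; suc)
open import Data.Fin using (Fin; zero; suc)
open import Data.List using (List; []; _∷_; _++_; map; concatMap)
open import Data.List.Properties using (map-++; concatMap-++; concatMap-cong; ++-identityʳ)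
open import Data.Vec using (Vec; lookup) renaming (_∷_ to _▸_)
open import Relation.Binary.PropositionalEquality
open ≡-Reasoning

dropZero-++ : ∀ {n} (xs ys : List (Fin (suc n))) →
  dropZero (xs ++ ys) ≡ dropZero xs ++ dropZero ys
dropZero-++ []           ys = refl
dropZero-++ (zero  ∷ xs) ys = dropZero-++ xs ys
dropZero-++ (suc i ∷ xs) ys = cong (i ∷_) (dropZero-++ xs ys)

dropZero-map-suc : ∀ {n} (xs : List (Fin n)) → dropZero (map suc xs) ≡ xs
dropZero-map-suc []       = refl
dropZero-map-suc (x ∷ xs) = cong (x ∷_) (dropZero-map-suc xs)

dropZero-map-extR : ∀ {n n'} (ρ : Fin n → Fin n') (xs : List (Fin (suc n))) →
  dropZero (map (extR ρ) xs) ≡ map ρ (dropZero xs)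
dropZero-map-extR ρ []           = refl
dropZero-map-extR ρ (zero  ∷ xs) = dropZero-map-extR ρ xs
dropZero-map-extR ρ (suc i ∷ xs) = cong (ρ i ∷_) (dropZero-map-extR ρ xs)

fa-renA : ∀ {K n n' m} (ρ : Fin n → Fin n') (t : Tm K n m) →
  fa (renA ρ t) ≡ map ρ (fa t)
fa-renA ρ (con c)      = refl
fa-renA ρ (atom a)     = refl
fa-renA ρ (unk X)      = refl
fa-renA ρ (lam A r)    =
  trans (cong dropZero (fa-renA (extR ρ) r)) (dropZero-map-extR ρ (fa r))
fa-renA ρ (app r s)    =
  trans (cong₂ _++_ (fa-renA ρ r) (fa-renA ρ s)) (sym (map-++ ρ (fa r) (fa s)))
fa-renA ρ (box r)      = fa-renA ρ r
fa-renA ρ (letbox s r) =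
  trans (cong₂ _++_ (fa-renA ρ r) (fa-renA ρ s)) (sym (map-++ ρ (fa r) (fa s)))

fa-renU : ∀ {K n m m'} (ρ : Fin m → Fin m') (t : Tm K n m) → fa (renU ρ t) ≡ fa t
fa-renU ρ (con c)      = refl
fa-renU ρ (atom a)     = refl
fa-renU ρ (unk X)      = refl
fa-renU ρ (lam A r)    = cong dropZero (fa-renU ρ r)
fa-renU ρ (app r s)    = cong₂ _++_ (fa-renU ρ r) (fa-renU ρ s)
fa-renU ρ (box r)      = fa-renU ρ r
fa-renU ρ (letbox s r) = cong₂ _++_ (fa-renU (extR ρ) r) (fa-renU ρ s)

faᶜ : ∀ {K n n' m} → (Fin n → Tm K n' m) → List (Fin n) → List (Fin n')
faᶜ σ = concatMap (λ i → fa (σ i))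

dropZero-faᶜ-extSA : ∀ {K n n' m} (σ : Fin n → Tm K n' m) (xs : List (Fin (suc n))) →
  dropZero (faᶜ (extSA σ) xs) ≡ faᶜ σ (dropZero xs)
dropZero-faᶜ-extSA σ []           = refl
dropZero-faᶜ-extSA σ (zero  ∷ xs) = dropZero-faᶜ-extSA σ xs
dropZero-faᶜ-extSA σ (suc i ∷ xs) = begin
  dropZero (fa (renA suc (σ i)) ++ faᶜ (extSA σ) xs)
    ≡⟨ dropZero-++ (fa (renA suc (σ i))) _ ⟩
  dropZero (fa (renA suc (σ i))) ++ dropZero (faᶜ (extSA σ) xs)
    ≡⟨ cong₂ _++_ weakened (dropZero-faᶜ-extSA σ xs) ⟩
  fa (σ i) ++ faᶜ σ (dropZero xs)  ∎
  where
  weakened : dropZero (fa (renA suc (σ i))) ≡ fa (σ i)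
  weakened = trans (cong dropZero (fa-renA suc (σ i))) (dropZero-map-suc (fa (σ i)))

fa-substA : ∀ {K n n' m} (σ : Fin n → Tm K n' m) (t : Tm K n m) →
  fa (substA σ t) ≡ faᶜ σ (fa t)
fa-substA σ (con c)      = refl
fa-substA σ (atom a)     = sym (++-identityʳ (fa (σ a)))
fa-substA σ (unk X)      = refl
fa-substA σ (lam A r)    =
  trans (cong dropZero (fa-substA (extSA σ) r)) (dropZero-faᶜ-extSA σ (fa r))
fa-substA σ (app r s)    =
  trans (cong₂ _++_ (fa-substA σ r) (fa-substA σ s))
        (sym (concatMap-++ (λ i → fa (σ i)) (fa r) (fa s)))
fa-substA σ (box r)      = fa-substA σ r
fa-substA σ (letbox s r) = begin
  fa (substA σ' r) ++ fa (substA σ s)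
    ≡⟨ cong₂ _++_ (fa-substA σ' r) (fa-substA σ s) ⟩
  faᶜ σ' (fa r) ++ faᶜ σ (fa s)
    ≡⟨ cong (_++ faᶜ σ (fa s)) (concatMap-cong (λ i → fa-renU suc (σ i)) (fa r)) ⟩
  faᶜ σ (fa r) ++ faᶜ σ (fa s)
    ≡⟨ concatMap-++ (λ i → fa (σ i)) (fa r) (fa s) ⟨
  faᶜ σ (fa r ++ fa s)  ∎
  where
  σ' = λ i → renU suc (σ i)

-- σ substitutes closed terms (no free atoms) for unknowns, as in r[X:=□s].
ClosedU : ∀ {K n m m'} → (Fin m → Tm K n m') → Set
ClosedU σ = ∀ X → fa (σ X) ≡ []

ClosedU-weakenA : ∀ {K n m m'} (σ : Fin m → Tm K n m') →
  ClosedU σ → ClosedU (λ X → renA suc (σ X))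
ClosedU-weakenA σ closed X = trans (fa-renA suc (σ X)) (cong (map suc) (closed X))

ClosedU-extSU : ∀ {K n m m'} {σ : Fin m → Tm K n m'} → ClosedU σ → ClosedU (extSU σ)
ClosedU-extSU          closed zero    = refl
ClosedU-extSU {σ = σ}  closed (suc X) = trans (fa-renU suc (σ X)) (closed X)

fa-substU : ∀ {K n m m'} (σ : Fin m → Tm K n m') → ClosedU σ → (t : Tm K n m) →
  fa (substU σ t) ≡ fa t
fa-substU σ closed (con c)      = refl
fa-substU σ closed (atom a)     = refl
fa-substU σ closed (unk X)      = closed X
fa-substU σ closed (lam A r)    =
  cong dropZero (fa-substU (λ i → renA suc (σ i)) (ClosedU-weakenA σ closed) r)
fa-substU σ closed (app r s)    = cong₂ _++_ (fa-substU σ closed r) (fa-substU σ closed s)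
fa-substU σ closed (box r)      = fa-substU σ closed r
fa-substU σ closed (letbox s r) =
  cong₂ _++_ (fa-substU (extSU σ) (ClosedU-extSU closed) r) (fa-substU σ closed s)

module _ {K : Set} (ty : K → Ty) where

  RenA : ∀ {n n'} → Vec Ty n → Vec Ty n' → (Fin n → Fin n') → Set
  RenA Γ Γ' ρ = ∀ a → lookup Γ' (ρ a) ≡ lookup Γ a

  RenA-extR : ∀ {n n'} {Γ : Vec Ty n} {Γ' : Vec Ty n'} {ρ : Fin n → Fin n'} (A : Ty) →
    RenA Γ Γ' ρ → RenA (A ▸ Γ) (A ▸ Γ') (extR ρ)
  RenA-extR A respects zero    = refl
  RenA-extR A respects (suc a) = respects a

  renA-ty : ∀ {n n' m} {Γ : Vec Ty n} {Γ' : Vec Ty n'} {Δ : Vec Ty m} {ρ : Fin n → Fin n'} →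
    RenA Γ Γ' ρ → ∀ {t A} → ty ⊢ Γ ∣ Δ ⊢ t ∶ A → ty ⊢ Γ' ∣ Δ ⊢ renA ρ t ∶ A
  renA-ty {ρ = ρ} respects (hyp a) =
    subst (ty ⊢ _ ∣ _ ⊢ atom (ρ a) ∶_) (respects a) (hyp (ρ a))
  renA-ty respects (const c)        = const c
  renA-ty respects (→I {A = A} d)   = →I (renA-ty (RenA-extR A respects) d)
  renA-ty respects (→E d e)         = →E (renA-ty respects d) (renA-ty respects e)
  renA-ty {ρ = ρ} respects (□I {r = r} d closed) =
    □I (renA-ty respects d) (trans (fa-renA ρ r) (cong (map ρ) closed))
  renA-ty respects (□E d e)         = □E (renA-ty respects d) (renA-ty respects e)
  renA-ty respects (ext X eq)       = ext X eq

  weakenA-ty : ∀ {n m} {Γ : Vec Ty n} {Δ : Vec Ty m} {t A} (B : Ty) →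
    ty ⊢ Γ ∣ Δ ⊢ t ∶ A → ty ⊢ (B ▸ Γ) ∣ Δ ⊢ renA suc t ∶ A
  weakenA-ty B = renA-ty (λ _ → refl)

  RenU : ∀ {m m'} → Vec Ty m → Vec Ty m' → (Fin m → Fin m') → Set
  RenU Δ Δ' ρ = ∀ X → lookup Δ' (ρ X) ≡ lookup Δ X

  RenU-extR : ∀ {m m'} {Δ : Vec Ty m} {Δ' : Vec Ty m'} {ρ : Fin m → Fin m'} (A : Ty) →
    RenU Δ Δ' ρ → RenU (A ▸ Δ) (A ▸ Δ') (extR ρ)
  RenU-extR A respects zero    = refl
  RenU-extR A respects (suc X) = respects X

  renU-ty : ∀ {n m m'} {Γ : Vec Ty n} {Δ : Vec Ty m} {Δ' : Vec Ty m'} {ρ : Fin m → Fin m'} →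
    RenU Δ Δ' ρ → ∀ {t A} → ty ⊢ Γ ∣ Δ ⊢ t ∶ A → ty ⊢ Γ ∣ Δ' ⊢ renU ρ t ∶ A
  renU-ty respects (hyp a)          = hyp a
  renU-ty respects (const c)        = const c
  renU-ty respects (→I d)           = →I (renU-ty respects d)
  renU-ty respects (→E d e)         = →E (renU-ty respects d) (renU-ty respects e)
  renU-ty {ρ = ρ} respects (□I {r = r} d closed) =
    □I (renU-ty respects d) (trans (fa-renU ρ r) closed)
  renU-ty respects (□E {A = A} d e) =
    □E (renU-ty respects d) (renU-ty (RenU-extR (□ A) respects) e)
  renU-ty {ρ = ρ} respects (ext X eq) = ext (ρ X) (trans (respects X) eq)

  weakenU-ty : ∀ {n m} {Γ : Vec Ty n} {Δ : Vec Ty m} {t A} (B : Ty) →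
    ty ⊢ Γ ∣ Δ ⊢ t ∶ A → ty ⊢ Γ ∣ (B ▸ Δ) ⊢ renU suc t ∶ A
  weakenU-ty B = renU-ty (λ _ → refl)

  SubstA : ∀ {n n' m} → Vec Ty n → Vec Ty n' → Vec Ty m → (Fin n → Tm K n' m) → Set
  SubstA Γ Γ' Δ σ = ∀ a → ty ⊢ Γ' ∣ Δ ⊢ σ a ∶ lookup Γ a

  substA-ty : ∀ {n n' m} {Γ : Vec Ty n} {Γ' : Vec Ty n'} {Δ : Vec Ty m} {σ : Fin n → Tm K n' m} →
    SubstA Γ Γ' Δ σ → ∀ {t A} → ty ⊢ Γ ∣ Δ ⊢ t ∶ A → ty ⊢ Γ' ∣ Δ ⊢ substA σ t ∶ A
  substA-ty typed (hyp a)        = typed a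
  substA-ty typed (const c)      = const c
  substA-ty typed (→I {A = A} d) = →I (substA-ty typed' d)
    where
    typed' : SubstA (A ▸ _) (A ▸ _) _ (extSA _)
    typed' zero    = hyp zero
    typed' (suc a) = weakenA-ty A (typed a)
  substA-ty typed (→E d e)       = →E (substA-ty typed d) (substA-ty typed e)
  substA-ty {σ = σ} typed (□I {r = r} d closed) =
    □I (substA-ty typed d) (trans (fa-substA σ r) (cong (faᶜ σ) closed))
  substA-ty typed (□E {A = A} d e) =
    □E (substA-ty typed d) (substA-ty (λ a → weakenU-ty (□ A) (typed a)) e)
  substA-ty typed (ext X eq)     = ext X eq

  SubstU : ∀ {n m m'} → Vec Ty n → Vec Ty m → Vec Ty m' → (Fin m → Tm K n m') → Set
  SubstU Γ Δ Δ' σ = ∀ X {A} → lookup Δ X ≡ (□ A) → ty ⊢ Γ ∣ Δ' ⊢ σ X ∶ A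

  -- Well-typed closed unknown substitutions preserve typing; closedness keeps
  -- the side condition of □I intact.
  substU-ty : ∀ {n m m'} {Γ : Vec Ty n} {Δ : Vec Ty m} {Δ' : Vec Ty m'} {σ : Fin m → Tm K n m'} →
    SubstU Γ Δ Δ' σ → ClosedU σ → ∀ {t A} → ty ⊢ Γ ∣ Δ ⊢ t ∶ A → ty ⊢ Γ ∣ Δ' ⊢ substU σ t ∶ A
  substU-ty typed closed (hyp a)        = hyp a
  substU-ty typed closed (const c)      = const c
  substU-ty {σ = σ} typed closed (→I {A = A} d) =
    →I (substU-ty (λ X eq → weakenA-ty A (typed X eq)) (ClosedU-weakenA σ closed) d)
  substU-ty typed closed (→E d e)       = →E (substU-ty typed closed d) (substU-ty typed closed e)
  substU-ty {σ = σ} typed closed (□I {r = r} d closedr) =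
    □I (substU-ty typed closed d) (trans (fa-substU σ closed r) closedr)
  substU-ty typed closed (□E {A = A} d e) =
    □E (substU-ty typed closed d) (substU-ty typed' (ClosedU-extSU closed) e)
    where
    typed' : SubstU _ ((□ A) ▸ _) ((□ A) ▸ _) (extSU _)
    typed' zero    eq = ext zero eq
    typed' (suc X) eq = weakenU-ty (□ A) (typed X eq)
  substU-ty typed closed (ext X eq)     = typed X eq

  [a≔]-ty : ∀ {n m} {Γ : Vec Ty n} {Δ : Vec Ty m} {A B r t} →
    ty ⊢ (A ▸ Γ) ∣ Δ ⊢ r ∶ B → ty ⊢ Γ ∣ Δ ⊢ t ∶ A → ty ⊢ Γ ∣ Δ ⊢ r [a≔ t ] ∶ B
  [a≔]-ty {t = t} dr dt = substA-ty typed dr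
    where
    typed : SubstA (_ ▸ _) _ _ (single t atom)
    typed zero    = dt
    typed (suc a) = hyp a

  [X≔□]-ty : ∀ {n m} {Γ : Vec Ty n} {Δ : Vec Ty m} {A B r s} →
    ty ⊢ Γ ∣ ((□ A) ▸ Δ) ⊢ r ∶ B → ty ⊢ Γ ∣ Δ ⊢ s ∶ A → fa s ≡ [] →
    ty ⊢ Γ ∣ Δ ⊢ r [X≔□ s ] ∶ B
  [X≔□]-ty {s = s} dr ds closeds = substU-ty typed closed dr
    where
    typed : SubstU _ (_ ▸ _) _ (single s unk)
    typed zero    refl = ds
    typed (suc X) eq   = ext X eq
    closed : ClosedU (single s unk)
    closed zero    = closeds
    closed (suc X) = refl

proposition4p10 : {K : Set} (ty : K → Ty) {n m : ℕ} (Γ : Vec Ty n) (Δ : Vec Ty m)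
    (r r' : Tm K n m) (A : Ty) →
    ty ⊢ Γ ∣ Δ ⊢ r ∶ A → r ⟶ r' → ty ⊢ Γ ∣ Δ ⊢ r' ∶ A
proposition4p10 ty Γ Δ _ _ _ (→E (→I dr) dt)        (β _ _ _)      = [a≔]-ty ty dr dt
proposition4p10 ty Γ Δ _ _ _ (□E (□I ds closed) dr) (β□ _ _)       = [X≔□]-ty ty dr ds closed
proposition4p10 ty Γ Δ _ _ _ (→E d e)               (cnga p q)     =
  →E (proposition4p10 ty Γ Δ _ _ _ d p) (proposition4p10 ty Γ Δ _ _ _ e q)
proposition4p10 ty Γ Δ _ _ _ (→I d)                 (cngl p)       =
  →I (proposition4p10 ty _ Δ _ _ _ d p)
proposition4p10 ty Γ Δ _ _ _ (□E d e)               (cnge p q)     =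
  □E (proposition4p10 ty Γ Δ _ _ _ d q) (proposition4p10 ty Γ _ _ _ _ e p)
proposition4p10 ty Γ Δ _ _ _ (→E (const _) _)       (isappT _ _ _) = const top
proposition4p10 ty Γ Δ _ _ _ (→E (const _) _)       (isappF _ _ _) = const bot
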